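{- Let $P$ be a finite bounded poset with a recursive first atom set $\Omega$. For any rooted interval $[x,y]_r$ of $P$, the first atom chain $c(r,x,y)$ does not contain a pseudo descent.
   Context: A poset is bounded if it has a unique minimum $\hat 0$ and maximum $\hat 1$; $x\lessdot y$ denotes a cover relation; the length of $P$ is the length of its longest chain. A root of $x$ is a maximal chain of $[\hat0,x]$; a rooted interval $[x,y]_r$ is an interval with a root $r$ of $x$. For a chain $m$ containing $x$, $m^x=\{w\in m:w\le x\}$; $r\cup a$ means $r\cup\{a\}$. Recursive first atom set (RFAS): $P$ admits an RFAS if $P$ has length 1, or if for each $x<y$ in $P$ and each root $r$ of $x$ there is an atom $\Omega(r,x,y)$ of $[x,y]$ (the first atom of $[x,y]_r$) such that, whenever $a$ is an atom of $[x,y]$ with $a<y$ and $b=\Omega(r\cup a,a,y)$: (i) $a=\Omega(r,x,y)$ if and only if $a=\Omega(r,x,b)$; (ii) if $a\ne\Omega(r,x,y)=:a'$, there exist atoms $a_1,\dots,a_p$ of $[x,y]$ and elements $b_1,\dots,b_{p-1}$ with $a_p=\Omega(r,x,b)$, $a_1=a'$, and for all $1\le i\le p-1$, $b_i=\Omega(r\cup a_{i+1},a_{i+1},y)$ and $a_i=\Omega(r,x,b_i)$. The first atom chain $c(r,x,y)$ is the unique maximal chain $x=z_0\lessdot z_1\lessdot\cdots\lessdot z_q=y$ of $[x,y]$ with $z_{i+1}=\Omega(r\cup\{z_1,\dots,z_i\},z_i,y)$ for $0\le i\le q-2$. For a maximal chain $m: x=x_0\lessdot\cdots\lessdot x_n=y$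 of $[x,y]_r$, a triple $x_i\lessdot x_{i+1}\lessdot x_{i+2}$ is a pseudo descent of $m$ if $x_{i+1}\ne\Omega(r\cup\{x_1,\dots,x_i\},x_i,x_{i+2})$. -}

module Defs where

open import Data.Nat using (ℕ; suc)
open import Data.Fin using (Fin; zero; suc; fromℕ; inject₁)
open import Data.List using (List; []; _∷_; _++_; [_]; drop)
open import Data.List.Membership.Propositional using (_∈_)
open import Data.Product using (Σ; _×_; ∃; ∃-syntax)
open import Relation.Binary.PropositionalEquality using (_≡_; _≢_)
open import Relation.Binary.Structures using (IsPartialOrder)
open import Relation.Nullary using (¬_)
open import Data.Sum using (_⊎_)

record FinBoundedPoset : Set₁ where
  field
    Carrier        : Set
    _≤_            : Carrier → Carrier → Set
    isPartialOrder : IsPartialOrder _≡_ _≤_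
    elems          : List Carrier
    complete       : ∀ x → x ∈ elems
    0̂              : Carrier
    1̂              : Carrier
    0̂-min          : ∀ x → 0̂ ≤ x
    1̂-max          : ∀ x → x ≤ 1̂

module Notions (P : FinBoundedPoset) where
  open FinBoundedPoset P

  _<_ : Carrier → Carrier → Set
  x < y = x ≤ y × x ≢ y

  _⋖_ : Carrier → Carrier → Set
  x ⋖ y = x < y × (∀ z → x ≤ z → z ≤ y → z ≡ x ⊎ z ≡ y)

  Atom : Carrier → Carrier → Carrier → Set
  Atom x y a = x ⋖ a × a ≤ y

  -- MaxChain x y zs : zs = (z₀ , … , z_q) is a maximal chain of [x,y],
  -- listed in increasing order: x = z₀ ⋖ z₁ ⋖ ⋯ ⋖ z_q = y.
  data MaxChain : Carrier → Carrier → List Carrier → Set where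
    done : ∀ {x} → MaxChain x x (x ∷ [])
    step : ∀ {x z y zs} → x ⋖ z → MaxChain z y zs → MaxChain x y (x ∷ zs)

  Root : List Carrier → Carrier → Set
  Root r x = MaxChain 0̂ x r

  -- Type of a candidate first-atom assignment Ω(r,x,y); r ∪ a is r ++ [ a ].
  FirstAtomMap : Set
  FirstAtomMap = List Carrier → Carrier → Carrier → Carrier

  IsRFAS : FirstAtomMap → Set
  IsRFAS Ω =
    ∀ x y r → x < y → Root r x →
      Atom x y (Ω r x y) ×
      (∀ a → Atom x y a → a < y →
        let b = Ω (r ++ [ a ]) a y in
        ((a ≡ Ω r x y → a ≡ Ω r x b) × (a ≡ Ω r x b → a ≡ Ω r x y)) ×
        -- (ii)  atoms a₁,…,a_p are as (zero,…,fromℕ p′) with p = p′+1,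
        --       elements b₁,…,b_{p-1} are bs zero,…
        (a ≢ Ω r x y →
          Σ ℕ λ p′ → Σ (Fin (suc p′) → Carrier) λ as → Σ (Fin p′ → Carrier) λ bs →
            (∀ i → Atom x y (as i)) ×
            as (fromℕ p′) ≡ Ω r x b ×
            as zero ≡ Ω r x y ×
            (∀ (i : Fin p′) →
               bs i ≡ Ω (r ++ [ as (suc i) ]) (as (suc i)) y ×
               as (inject₁ i) ≡ Ω r x (bs i))))

  -- zs is the first atom chain c(r,x,y): a maximal chain of [x,y] with
  -- z_{i+1} = Ω(r ∪ {z₁,…,zᵢ}, zᵢ, y) for 0 ≤ i ≤ q-2.
  -- Writing zs = pre ++ u ∷ v ∷ w ∷ rest with u = zᵢ, v = z_{i+1}, w = z_{i+2},
  -- the set {z₁,…,zᵢ} is drop 1 (pre ++ [ u ]).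
  IsFirstAtomChain : FirstAtomMap → List Carrier → Carrier → Carrier → List Carrier → Set
  IsFirstAtomChain Ω r x y zs =
    MaxChain x y zs ×
    (∀ pre u v w rest → zs ≡ pre ++ (u ∷ v ∷ w ∷ rest) →
       v ≡ Ω (r ++ drop 1 (pre ++ [ u ])) u y)

  HasPseudoDescent : FirstAtomMap → List Carrier → List Carrier → Set
  HasPseudoDescent Ω r zs =
    ∃[ pre ] ∃[ u ] ∃[ v ] ∃[ w ] ∃[ rest ]
      (zs ≡ pre ++ (u ∷ v ∷ w ∷ rest) ×
       v ≢ Ω (r ++ drop 1 (pre ++ [ u ])) u w)

-- Let u ⋖ v ⋖ w be consecutive in c(r,x,y) and r' the root of u obtained by
-- extending r along the chain. By construction v = Ω(r',u,y), and either w = y,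
-- or w = Ω(r' ∪ v, v, y), in which case condition (i) of the RFAS, applied to
-- the atom v of [u,y], gives v = Ω(r',u,w). Either way the triple is no
-- pseudo descent.
module Submission where

open import Defs
open import Data.List using (List; []; _∷_; _++_; [_]; drop)
open import Data.List.Properties using (++-assoc)
open import Data.Product using (_,_; proj₁; proj₂; _×_)
open import Relation.Binary.PropositionalEquality
  using (_≡_; refl; sym; cong; subst; module ≡-Reasoning)
open import Relation.Binary.Structures using (IsPartialOrder)
open import Relation.Nullary using (¬_)

drop-1-snoc-++ : ∀ {A : Set} (xs : List A) x ys →
                 drop 1 ((xs ++ [ x ]) ++ ys) ≡ drop 1 (xs ++ [ x ]) ++ ys
drop-1-snoc-++ []       x ys = refl
drop-1-snoc-++ (_ ∷ xs) x ys = refl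

module FirstAtomChains (P : FinBoundedPoset) where
  open FinBoundedPoset P
  open Notions P
  open IsPartialOrder isPartialOrder using (antisym; reflexive) renaming (trans to ≤-trans)

  ⋖⇒≤ : ∀ {u v} → u ⋖ v → u ≤ v
  ⋖⇒≤ ((u≤v , _) , _) = u≤v

  ⋖-≤⇒< : ∀ {u v y} → u ⋖ v → v ≤ y → u < y
  ⋖-≤⇒< {v = v} ((u≤v , u≢v) , _) v≤y =
    ≤-trans u≤v v≤y , λ u≡y → u≢v (antisym u≤v (subst (v ≤_) (sym u≡y) v≤y))

  MaxChain⇒≤ : ∀ {x y zs} → MaxChain x y zs → x ≤ y
  MaxChain⇒≤ done           = reflexive refl
  MaxChain⇒≤ (step x⋖z ch) = ≤-trans (⋖⇒≤ x⋖z) (MaxChain⇒≤ ch)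

  MaxChain-[_]⇒≡ : ∀ {x y} → MaxChain x y [ x ] → x ≡ y
  MaxChain-[_]⇒≡ done = refl

  MaxChain-uncons : ∀ {u v y zs} → MaxChain u y (u ∷ v ∷ zs) → u ⋖ v × MaxChain v y (v ∷ zs)
  MaxChain-uncons (step u⋖v done)       = u⋖v , done
  MaxChain-uncons (step u⋖v (step p c)) = u⋖v , step p c

  -- The lists share the endpoint b, which drop 1 removes from the second one.
  MaxChain-join : ∀ {a b c L M} → MaxChain a b L → MaxChain b c M →
                  MaxChain a c (L ++ drop 1 M)
  MaxChain-join done done            = done
  MaxChain-join done (step b⋖z ch)   = step b⋖z ch
  MaxChain-join (step a⋖z ch) chain = step a⋖z (MaxChain-join ch chain)

  MaxChain-split : ∀ {x y} pre u s → MaxChain x y (pre ++ u ∷ s) →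
                   MaxChain x u (pre ++ [ u ]) × MaxChain u y (u ∷ s)
  MaxChain-split []               u s done          = done , done
  MaxChain-split []               u s (step u⋖z ch) = done , step u⋖z ch
  MaxChain-split (_ ∷ [])         u s (step x⋖z ch) =
    let below , above = MaxChain-split [] u s ch in step x⋖z below , above
  MaxChain-split (_ ∷ pre@(_ ∷ _)) u s (step x⋖z ch) =
    let below , above = MaxChain-split pre u s ch in step x⋖z below , above

  IsRFAS⇒Ω-restrict : ∀ {Ω} → IsRFAS Ω → ∀ {r u v y} → Root r u → u ⋖ v → v < y →
                      v ≡ Ω r u y → v ≡ Ω r u (Ω (r ++ [ v ]) v y)
  IsRFAS⇒Ω-restrict rfas {r} {u} {v} {y} root u⋖v v<y@(v≤y , _) =
    proj₁ (proj₁ (proj₂ (rfas u y r (⋖-≤⇒< u⋖v v≤y) root) v (u⋖v , v≤y) v<y))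

  MaxChain-triple : ∀ {x y} pre u v w rest → MaxChain x y (pre ++ u ∷ v ∷ w ∷ rest) →
                    MaxChain x u (pre ++ [ u ]) × u ⋖ v × v ⋖ w × MaxChain w y (w ∷ rest)
  MaxChain-triple pre u v w rest chain =
    let below , fromU = MaxChain-split pre u (v ∷ w ∷ rest) chain
        u⋖v , fromV   = MaxChain-uncons fromU
        v⋖w , fromW   = MaxChain-uncons fromV
    in below , u⋖v , v⋖w , fromW

  firstAtomChain-step : ∀ {Ω} → IsRFAS Ω → ∀ {r x y zs} → Root r x →
    IsFirstAtomChain Ω r x y zs → ∀ pre u v w rest → zs ≡ pre ++ u ∷ v ∷ w ∷ rest →
    v ≡ Ω (r ++ drop 1 (pre ++ [ u ])) u w
  firstAtomChain-step {Ω} rfas {r} root (chain , first) pre u v w [] refl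
    with MaxChain-triple pre u v w [] chain
  ... | _ , _ , _ , fromW =
    subst (λ t → v ≡ Ω (r ++ drop 1 (pre ++ [ u ])) u t) (sym (MaxChain-[ fromW ]⇒≡))
      (first pre u v w [] refl)
  firstAtomChain-step {Ω} rfas {r} {y = y} root (chain , first) pre u v w (w′ ∷ rest) refl
    with MaxChain-triple pre u v w (w′ ∷ rest) chain
  ... | below , u⋖v , v⋖w , fromW =
    subst (λ t → v ≡ Ω r′ u t) (sym w≡Ω)
      (IsRFAS⇒Ω-restrict rfas (MaxChain-join root below) u⋖v
        (⋖-≤⇒< v⋖w (MaxChain⇒≤ fromW)) (first pre u v w (w′ ∷ rest) refl))
    where
    r′ : List Carrier
    r′ = r ++ drop 1 (pre ++ [ u ])

    w≡Ω : w ≡ Ω (r′ ++ [ v ]) v y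
    w≡Ω = begin
      w                                             ≡⟨ first (pre ++ [ u ]) v w w′ rest
                                                         (sym (++-assoc pre [ u ] _)) ⟩
      Ω (r ++ drop 1 ((pre ++ [ u ]) ++ [ v ])) v y ≡⟨ cong (λ l → Ω (r ++ l) v y) (drop-1-snoc-++ pre u [ v ]) ⟩
      Ω (r ++ (drop 1 (pre ++ [ u ]) ++ [ v ])) v y ≡⟨ cong (λ l → Ω l v y) (sym (++-assoc r _ [ v ])) ⟩
      Ω (r′ ++ [ v ]) v y                           ∎
      where open ≡-Reasoning

proposition5p8 : (P : FinBoundedPoset) → (Ω : Notions.FirstAtomMap P) → Notions.IsRFAS P Ω →
    ∀ (x y : FinBoundedPoset.Carrier P) (r zs : List (FinBoundedPoset.Carrier P)) →
    FinBoundedPoset._≤_ P x y → Notions.Root P r x →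
    Notions.IsFirstAtomChain P Ω r x y zs → ¬ Notions.HasPseudoDescent P Ω r zs
proposition5p8 P Ω rfas x y r zs _ root fac (pre , u , v , w , rest , zs≡ , v≢Ω) =
  v≢Ω (FirstAtomChains.firstAtomChain-step P rfas root fac pre u v w rest zs≡)
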